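{- Let $\beta\geq 2$. In the CONGEST model, any $\beta$-ruling edge set of a graph $G$ can be transformed into a $2$-ruling edge set of $G$ in $O(\beta)$ rounds of communication.
   Context: CONGEST model: the network is an $n$-node graph $G=(V,E)$; each node has a unique $O(\log n)$-bit ID; computation proceeds in synchronous rounds, in each of which every node may send a message of $O(\log n)$ bits to each neighbor and perform unbounded local computation. The input ruling edge set is given distributedly (each node knows which of its incident edges belong to it), and so is the output. The distance $\mathrm{dist}(e,f)$ between two edges is the distance between the corresponding nodes in the line graph of $G$. An $(\alpha,\beta)$-ruling edge set of $G$ is a set $R\subseteq E$ such that any two distinct edges of $R$ are at distance at least $\alpha$ and every edge $e\in E$ has some $f\in R$ with $\mathrm{dist}(e,f)\leq\beta$; a $\beta$-ruling edge set is a $(2,\beta)$-ruling edge set. -}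

module Defs where

open import Data.Nat using (ℕ; zero; suc; _+_; _*_; _∸_; _^_; _≤_; _<_)
open import Data.Fin using (Fin)
open import Data.Bool using (Bool; true; false; _∧_)
open import Data.List using (List; map; filterᵇ; allFin)
open import Data.Maybe using (Maybe)
open import Data.Product using (Σ; ∃; _×_; _,_; proj₁; proj₂)
open import Data.Sum using (_⊎_)
open import Relation.Nullary using (¬_)
open import Relation.Binary.PropositionalEquality using (_≡_)

record Graph (n : ℕ) : Set where
  field
    adj    : Fin n → Fin n → Bool
    sym    : ∀ u v → adj u v ≡ adj v u
    irrefl : ∀ v → adj v v ≡ false
open Graph public

-- An edge {u,v} is written as the (ordered) pair (u , v) of its endpoints;
-- an edge set is a symmetric Bool-valued relation contained in adj.
EdgeRel : ℕ → Set
EdgeRel n = Fin n → Fin n → Bool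

IsEdgeSet : ∀ {n} → Graph n → EdgeRel n → Set
IsEdgeSet {n} G R =
  (∀ (u v : Fin n) → R u v ≡ R v u) × (∀ (u v : Fin n) → R u v ≡ true → adj G u v ≡ true)

SameEdge : ∀ {n} → Fin n × Fin n → Fin n × Fin n → Set
SameEdge (u , v) (u' , v') = (u ≡ u' × v ≡ v') ⊎ (u ≡ v' × v ≡ u')

-- the two edges share an endpoint (adjacency in the line graph,
-- up to equality of the edges, which is harmless for "distance ≤ d")
Touch : ∀ {n} → Fin n × Fin n → Fin n × Fin n → Set
Touch (u , v) (u' , v') = (u ≡ u' ⊎ u ≡ v') ⊎ (v ≡ u' ⊎ v ≡ v')

data Within {n} (G : Graph n) : ℕ → Fin n × Fin n → Fin n × Fin n → Set where
  here : ∀ {d e} → Within G d e e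
  step : ∀ {d e a b f} → adj G a b ≡ true → Touch e (a , b) →
         Within G d (a , b) f → Within G (suc d) e f

Ruling : ∀ {n} → ℕ → ℕ → Graph n → EdgeRel n → Set
Ruling {n} α β G R =
  (∀ (u v u' v' : Fin n) → R u v ≡ true → R u' v' ≡ true →
     ¬ SameEdge (u , v) (u' , v') → ¬ Within G (α ∸ 1) (u , v) (u' , v'))
  ×
  (∀ (u v : Fin n) → adj G u v ≡ true →
     ∃ λ u' → ∃ λ v' → R u' v' ≡ true × Within G β (u , v) (u' , v'))

-- CONGEST algorithms (KT1: each node initially knows n, β, its ID, and the
-- IDs of its neighbours together with the input bit of each incident edge).
-- Messages have O(log n) bits: they are elements of Fin ((2 + n) ^ k).

Msg : ℕ → ℕ → Set
Msg k n = Fin ((2 + n) ^ k)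

record Algorithm (k : ℕ) : Set₁ where
  field
    State  : Set
    -- n, β, own ID, list of (neighbour ID , is the incident edge in the input set)
    init   : (n β myId : ℕ) → List (ℕ × Bool) → State
    -- message sent to the neighbour with the given ID (nothing = no message)
    send   : (n β : ℕ) → State → ℕ → Maybe (Msg k n)
    -- new state from list of (neighbour ID , message received from it)
    update : (n β : ℕ) → State → List (ℕ × Maybe (Msg k n)) → State
    -- output: is the incident edge to the neighbour with the given ID selected
    output : (n β : ℕ) → State → ℕ → Bool
open Algorithm public

neighbours : ∀ {n} → Graph n → Fin n → List (Fin n)
neighbours {n} G v = filterᵇ (adj G v) (allFin n)

run : ∀ {k n} (A : Algorithm k) (G : Graph n) (ID : Fin n → ℕ) (β : ℕ) (R : EdgeRel n) →
      ℕ → Fin n → State A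
run {n = n} A G ID β R zero v =
  init A n β (ID v) (map (λ u → ID u , R v u) (neighbours G v))
run {n = n} A G ID β R (suc t) v =
  update A n β (run A G ID β R t v)
    (map (λ u → ID u , send A n β (run A G ID β R t u) (ID v)) (neighbours G v))

outputAt : ∀ {k n} (A : Algorithm k) (G : Graph n) (ID : Fin n → ℕ) (β : ℕ) (R : EdgeRel n) →
           ℕ → Fin n → Fin n → Bool
outputAt {n = n} A G ID β R T u v = output A n β (run A G ID β R T u) (ID v)

outputSet : ∀ {k n} (A : Algorithm k) (G : Graph n) (ID : Fin n → ℕ) (β : ℕ) (R : EdgeRel n) →
            ℕ → EdgeRel n
outputSet A G ID β R T u v = adj G u v ∧ outputAt A G ID β R T u v

-- Grow a BFS forest from the endpoints of the input edges for β rounds: as every edge lies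
-- within distance β of an input edge, every non-isolated node gets a depth d ≤ β and, if d > 0,
-- a parent of depth d − 1. Then match the layers bottom-up, layer d in round 2β − d: an
-- unmatched node of depth ≥ 2 proposes to its parent, an unmatched parent takes the first
-- proposer, and the proposer learns this from an accept message one round later. The output is
-- the input edges together with this matching. Roots are never matched, so no two output edges
-- share a node; a node of depth 0 or 1 is on or next to an input edge, and a deeper node is
-- matched or has a matched parent, so every edge is within distance 2 of an output edge.

module Submission where

open import Defs hiding (sym)
open import Data.Nat using (ℕ; zero; suc; _+_; _*_; _∸_; _^_; _≤_; _<_; z≤n; s≤s; _≤?_; _<?_)
open import Data.Nat.Properties
  using (_≟_; ≤-refl; ≤-trans; ≤-<-trans; <⇒≤; <⇒≱; m≤n⇒m≤1+n; n≤1+n; m≤n⇒m<n∨m≡n; m≤m+n;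
         +-suc; 1+n≢n; m≢1+n+m; +-cancelʳ-≡; +-monoˡ-≤; +-monoʳ-≤; m+n≤o⇒m≤o∸n; m+[n∸m]≡n)
open import Data.Fin using (Fin; zero; suc)
import Data.Fin.Properties as Fin
open import Data.Bool using (Bool; true; false; if_then_else_)
import Data.Bool.Properties as Bool
open import Data.List using (List; []; _∷_; map; allFin)
open import Data.List.Membership.Propositional using (_∈_)
open import Data.List.Membership.Propositional.Properties using (∈-filter⁺; ∈-filter⁻; ∈-allFin)
open import Data.List.Relation.Unary.Any using (here; there)
open import Data.Maybe using (Maybe; just; nothing)
import Data.Maybe.Properties as Maybe
open import Data.Product using (Σ; ∃; _×_; _,_; proj₁; proj₂; <_,_>)
open import Data.Sum using (_⊎_; inj₁; inj₂)
open import Function using (id; _∘_; _⇔_; mk⇔; Equivalence)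
open import Function.Definitions using (Injective)
import Function.Properties.Equivalence as ⇔
open import Relation.Nullary using (¬_; Dec; yes; no; does; contradiction)
open import Relation.Nullary.Decidable using (_×-dec_; _⊎-dec_; dec-true; does-⇔; toWitness; isYes≗does)
open import Relation.Binary.PropositionalEquality using (_≡_; refl; sym; trans; cong; subst)

module _ {A : Set} where

  lookup : ℕ → List (ℕ × A) → Maybe A
  lookup x [] = nothing
  lookup x ((y , a) ∷ L) with x ≟ y
  ... | yes _ = just a
  ... | no _  = lookup x L

  firstKeyWith : (A → Bool) → List (ℕ × A) → Maybe ℕ
  firstKeyWith p [] = nothing
  firstKeyWith p ((y , a) ∷ L) = if p a then just y else firstKeyWith p L

  module _ {B : Set} (key : B → ℕ) (f : B → A) where

    lookup-∈ : Injective _≡_ _≡_ key → ∀ {y ys} → y ∈ ys → lookup (key y) (map < key , f > ys) ≡ just (f y)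
    lookup-∈ inj {y} {z ∷ ys} y∈ with key y ≟ key z
    ... | yes eq with inj eq
    ...   | refl = refl
    lookup-∈ inj {y} {z ∷ ys} (here refl) | no ne = contradiction refl ne
    lookup-∈ inj {y} {z ∷ ys} (there y∈) | no _ = lookup-∈ inj y∈

    lookup⁻ : ∀ {x a} ys → lookup x (map < key , f > ys) ≡ just a →
              ∃ λ y → y ∈ ys × x ≡ key y × f y ≡ a
    lookup⁻ {x} (y ∷ ys) eq with x ≟ key y
    ... | yes x≡ = y , here refl , x≡ , Maybe.just-injective eq
    ... | no _ with lookup⁻ ys eq
    ...   | z , z∈ , x≡ , fz = z , there z∈ , x≡ , fz

    firstKeyWith⁻ : ∀ p ys {x} → firstKeyWith p (map < key , f > ys) ≡ just x →
                    ∃ λ y → y ∈ ys × x ≡ key y × p (f y) ≡ true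
    firstKeyWith⁻ p (y ∷ ys) eq with p (f y) in py
    ... | true = y , here refl , sym (Maybe.just-injective eq) , py
    ... | false with firstKeyWith⁻ p ys eq
    ...   | z , z∈ , x≡ , pz = z , there z∈ , x≡ , pz

    firstKeyWith⁺ : ∀ p {y ys} → y ∈ ys → p (f y) ≡ true →
                    ∃ λ x → firstKeyWith p (map < key , f > ys) ≡ just x
    firstKeyWith⁺ p {ys = z ∷ ys} y∈ py with p (f z) in pz
    ... | true = key z , refl
    firstKeyWith⁺ p {ys = z ∷ ys} (here refl) py | false = contradiction (trans (sym pz) py) λ ()
    firstKeyWith⁺ p {ys = z ∷ ys} (there y∈) py | false = firstKeyWith⁺ p y∈ py

maybe-case : ∀ {A : Set} (m : Maybe A) → m ≡ nothing ⊎ ∃ λ a → m ≡ just a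
maybe-case nothing  = inj₁ refl
maybe-case (just a) = inj₂ (a , refl)

persists : ∀ (P : ℕ → Set) → (∀ {t} → P t → P (suc t)) → ∀ {t t'} → t ≤ t' → P t → P t'
persists P next {t' = zero}   z≤n p = p
persists P next {t' = suc t'} t≤ p with m≤n⇒m<n∨m≡n t≤
... | inj₁ (s≤s t≤t') = next (persists P next t≤t' p)
... | inj₂ refl       = p

just-onset : ∀ {A : Set} (f : ℕ → Maybe A) → (∀ {t a} → f t ≡ just a → f (suc t) ≡ just a) →
             f 0 ≡ nothing → ∀ {t a} → f t ≡ just a → ∃ λ s → s < t × f s ≡ nothing × f (suc s) ≡ just a
just-onset f next f0 {zero} ft = contradiction (trans (sym f0) ft) λ ()
just-onset f next f0 {suc t} ft with maybe-case (f t)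
... | inj₁ none = t , ≤-refl , none , ft
... | inj₂ (a' , some) with trans (sym (next some)) ft
...   | refl with just-onset f next f0 some
...     | s , s<t , fs , fs' = s , m≤n⇒m≤1+n s<t , fs , fs'

∈-neighbours⁺ : ∀ {n} (G : Graph n) {u v} → adj G u v ≡ true → v ∈ neighbours G u
∈-neighbours⁺ G {u} {v} uv = ∈-filter⁺ (λ x → Bool.T? (adj G u x)) (∈-allFin v) (Equivalence.from Bool.T-≡ uv)

∈-neighbours⁻ : ∀ {n} (G : Graph n) {u v} → v ∈ neighbours G u → adj G u v ≡ true
∈-neighbours⁻ G {u} v∈ =
  Equivalence.to Bool.T-≡ (proj₂ (∈-filter⁻ (λ x → Bool.T? (adj G u x)) {xs = allFin _} v∈))

adj-sym : ∀ {n} (G : Graph n) {u v} → adj G u v ≡ true → adj G v u ≡ true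
adj-sym G {u} {v} uv = trans (Graph.sym G v u) uv

sameEdge-otherEnd : ∀ {n} (G : Graph n) {u v v'} → adj G u v ≡ true → SameEdge (u , v) (u , v') → v ≡ v'
sameEdge-otherEnd G uv (inj₁ (_ , v≡v')) = v≡v'
sameEdge-otherEnd G uv (inj₂ (refl , refl)) = contradiction (trans (sym (irrefl G _)) uv) λ ()

-- Messages are elements of Fin (2 + k), i.e. Msg 1 n for k = n * 1. During the first β rounds
-- propose invites unreached neighbours into the forest.
pattern propose = zero
pattern accept  = suc zero

Inbox : ℕ → Set
Inbox k = List (ℕ × Maybe (Fin (2 + k)))

record Node : Set where
  field
    clock  : ℕ
    depth  : Maybe ℕ
    parent : ℕ
    mate   : Maybe ℕ
    inputs : List (ℕ × Bool)
open Node

-- Layer d acts in round 2β − d, so layers β, β − 1, …, 1 act in rounds β, …, 2β − 1.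
ActiveLayer : ℕ → ℕ → ℕ → Set
ActiveLayer β t d = β ≤ t × d + t ≡ 2 * β

activeLayer? : ∀ β t d → Dec (ActiveLayer β t d)
activeLayer? β t d = β ≤? t ×-dec d + t ≟ 2 * β

activeLayer-injective : ∀ {β t d d'} → ActiveLayer β t d → ActiveLayer β t d' → d ≡ d'
activeLayer-injective {t = t} (_ , e) (_ , e') = +-cancelʳ-≡ t _ _ (trans e (sym e'))

activeLayer-suc : ∀ {β t d} → ActiveLayer β t (suc d) → ActiveLayer β (suc t) d
activeLayer-suc {t = t} {d} (β≤t , e) = m≤n⇒m≤1+n β≤t , trans (+-suc d t) e

activeLayer-≤ : ∀ {β t d j} → ActiveLayer β t d → j ≤ d → j + t ≤ 2 * β
activeLayer-≤ {t = t} {j = j} (_ , e) j≤d = subst (j + t ≤_) e (+-monoˡ-≤ t j≤d)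

activeLayer-at : ∀ {β d} → d ≤ β → ActiveLayer β (2 * β ∸ d) d
activeLayer-at {β} {d} d≤β =
  m+n≤o⇒m≤o∸n β (+-monoʳ-≤ β (≤-trans d≤β (m≤m+n β 0))) ,
  m+[n∸m]≡n (≤-trans d≤β (m≤m+n β (β + 0)))

Explores : ℕ → ℕ → ℕ → Set
Explores β t d = t < β × d ≡ t

Proposes : ℕ → ℕ → ℕ → Node → ℕ → Set
Proposes β t d s x = ActiveLayer β t d × 2 ≤ d × mate s ≡ nothing × x ≡ parent s

Accepts : ℕ → ℕ → ℕ → Node → ℕ → Set
Accepts β t d s x = ActiveLayer β t d × mate s ≡ just x

invites? : ∀ β t d s x → Dec (Explores β t d ⊎ Proposes β t d s x)
invites? β t d s x =
  (t <? β ×-dec d ≟ t) ⊎-dec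
  (activeLayer? β t d ×-dec 2 ≤? d ×-dec Maybe.≡-dec _≟_ (mate s) nothing ×-dec x ≟ parent s)

accepts? : ∀ β t d s x → Dec (Accepts β t d s x)
accepts? β t d s x = activeLayer? β t d ×-dec Maybe.≡-dec _≟_ (mate s) (just x)

message : ∀ {k} → ℕ → Node → ℕ → Maybe (Fin (2 + k))
message β s x with depth s
... | nothing = nothing
... | just d with invites? β (clock s) d s x | accepts? β (clock s) d s x
...   | yes _ | _     = just propose
...   | no _  | yes _ = just accept
...   | no _  | no _  = nothing

isProposal : ∀ {k} → Maybe (Fin (2 + k)) → Bool
isProposal (just propose) = true
isProposal _              = false

isProposal⁻ : ∀ {k} {m : Maybe (Fin (2 + k))} → isProposal m ≡ true → m ≡ just propose
isProposal⁻ {m = just propose} _ = refl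

firstProposer : ∀ {k} → Inbox k → Maybe ℕ
firstProposer = firstKeyWith isProposal

accepted? : ∀ {k} (p : ℕ) (L : Inbox k) → Dec (lookup p L ≡ just (just accept))
accepted? p L = Maybe.≡-dec (Maybe.≡-dec Fin._≟_) (lookup p L) (just (just accept))

nextPosition : ∀ {k} → ℕ → Node → Inbox k → Maybe ℕ × ℕ
nextPosition β s L with depth s | clock s <? β | firstProposer L
... | nothing | yes _ | just p = just (suc (clock s)) , p
... | d       | _     | _      = d , parent s

confirmation : ∀ {k} → ℕ → Node → ℕ → Inbox k → Maybe ℕ
confirmation β s zero    L = nothing
confirmation β s (suc e) L with activeLayer? β (clock s) e ×-dec accepted? (parent s) L
... | yes _ = just (parent s)
... | no _  = nothing

nextMate : ∀ {k} → ℕ → Node → Inbox k → Maybe ℕ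
nextMate β s L with mate s | depth s
... | just m  | _       = just m
... | nothing | nothing = nothing
... | nothing | just d with activeLayer? β (clock s) (suc d)
...   | yes _ = firstProposer L
...   | no _  = confirmation β s d L

nextNode : ∀ {k} → ℕ → Node → Inbox k → Node
nextNode β s L = record
  { clock  = suc (clock s)
  ; depth  = proj₁ (nextPosition β s L)
  ; parent = proj₂ (nextPosition β s L)
  ; mate   = nextMate β s L
  ; inputs = inputs s
  }

rootDepth : List (ℕ × Bool) → Maybe ℕ
rootDepth L with firstKeyWith id L
... | just _  = just 0
... | nothing = nothing

rootDepth⁺ : ∀ L {x} → firstKeyWith id L ≡ just x → rootDepth L ≡ just 0
rootDepth⁺ L fk with firstKeyWith id L | fk
... | just _ | refl = refl

rootDepth⁻ : ∀ L {d} → rootDepth L ≡ just d → d ≡ 0 × ∃ λ x → firstKeyWith id L ≡ just x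
rootDepth⁻ L eq with firstKeyWith id L
rootDepth⁻ L refl | just x = refl , x , refl
rootDepth⁻ L ()   | nothing

-- The parent of a root is junk; only nodes of positive depth read it.
initialNode : List (ℕ × Bool) → Node
initialNode L = record { clock = 0 ; depth = rootDepth L ; parent = 0 ; mate = nothing ; inputs = L }

Selects : Node → ℕ → Set
Selects s x = lookup x (inputs s) ≡ just true ⊎ mate s ≡ just x

selects? : ∀ s x → Dec (Selects s x)
selects? s x = Maybe.≡-dec Bool._≟_ (lookup x (inputs s)) (just true) ⊎-dec Maybe.≡-dec _≟_ (mate s) (just x)

matchingAlgorithm : Algorithm 1
matchingAlgorithm = record
  { State  = Node
  ; init   = λ _ _ _ L → initialNode L
  ; send   = λ _ β s x → message β s x
  ; update = λ _ β s L → nextNode β s L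
  ; output = λ _ _ s x → does (selects? s x)
  }

module _ {k : ℕ} (β : ℕ) {s : Node} {x : ℕ} where

  message-propose⁺ : ∀ {t d} → clock s ≡ t → depth s ≡ just d → Explores β t d ⊎ Proposes β t d s x →
                     message {k} β s x ≡ just propose
  message-propose⁺ refl d≡ i with depth s | d≡
  ... | just d | refl with invites? β (clock s) d s x
  ...   | yes _  = refl
  ...   | no ¬i = contradiction i ¬i

  message-accept⁺ : ∀ {t d} → clock s ≡ t → depth s ≡ just d → Accepts β t d s x →
                    message {k} β s x ≡ just accept
  message-accept⁺ refl d≡ a@((β≤t , _) , m≡) with depth s | d≡
  ... | just d | refl with invites? β (clock s) d s x | accepts? β (clock s) d s x
  ...   | no _ | yes _  = refl
  ...   | no _ | no ¬a = contradiction a ¬a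
  ...   | yes (inj₁ (t<β , _)) | _ = contradiction β≤t (<⇒≱ t<β)
  ...   | yes (inj₂ (_ , _ , unmatched , _)) | _ = contradiction (trans (sym m≡) unmatched) λ ()

  message-propose⁻ : ∀ {t} → clock s ≡ t → message {k} β s x ≡ just propose →
                     ∃ λ d → depth s ≡ just d × (Explores β t d ⊎ Proposes β t d s x)
  message-propose⁻ refl eq with depth s
  message-propose⁻ refl () | nothing
  ... | just d with invites? β (clock s) d s x | accepts? β (clock s) d s x
  message-propose⁻ refl eq | just d | yes i | _ = d , refl , i
  message-propose⁻ refl () | just d | no _ | yes _
  message-propose⁻ refl () | just d | no _ | no _

  message-accept⁻ : message {k} β s x ≡ just accept → mate s ≡ just x
  message-accept⁻ eq with depth s
  message-accept⁻ () | nothing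
  ... | just d with invites? β (clock s) d s x | accepts? β (clock s) d s x
  message-accept⁻ () | just d | yes _ | _
  message-accept⁻ eq | just d | no _ | yes (_ , m≡) = m≡
  message-accept⁻ () | just d | no _ | no _

data Matches {k} (β t d : ℕ) (s : Node) (L : Inbox k) : ℕ → Set where
  adopts   : ∀ {m} → ActiveLayer β t (suc d) → firstProposer L ≡ just m → Matches β t d s L m
  confirms : ∀ {e} → d ≡ suc e → ActiveLayer β t e → lookup (parent s) L ≡ just (just accept) →
             Matches β t d s L (parent s)

module _ {k : ℕ} (β : ℕ) {s : Node} {L : Inbox k} where

  nextPosition-persists : ∀ {d} → depth s ≡ just d → nextPosition β s L ≡ (just d , parent s)
  nextPosition-persists d≡ with depth s | d≡
  ... | just d | refl = refl

  nextPosition⁺ : ∀ {t p} → clock s ≡ t → depth s ≡ nothing → t < β → firstProposer L ≡ just p →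
                  nextPosition β s L ≡ (just (suc t) , p)
  nextPosition⁺ refl d≡ t<β fp with depth s | d≡ | clock s <? β | firstProposer L | fp
  ... | nothing | refl | yes _   | just p | refl = refl
  ... | nothing | refl | no t≮β | _      | _    = contradiction t<β t≮β

  nextPosition⁻ : ∀ {t e} → clock s ≡ t → depth s ≡ nothing → proj₁ (nextPosition β s L) ≡ just e →
                  t < β × e ≡ suc t × firstProposer L ≡ just (proj₂ (nextPosition β s L))
  nextPosition⁻ refl d≡ eq with depth s | d≡ | clock s <? β | firstProposer L
  nextPosition⁻ refl d≡ eq | nothing | refl | yes t<β | just p = t<β , sym (Maybe.just-injective eq) , refl
  nextPosition⁻ refl d≡ () | nothing | refl | yes _ | nothing
  nextPosition⁻ refl d≡ () | nothing | refl | no _  | _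

  nextMate-persists : ∀ {m} → mate s ≡ just m → nextMate β s L ≡ just m
  nextMate-persists m≡ with mate s | m≡
  ... | just m | refl = refl

  confirmation⁺ : ∀ {e} → ActiveLayer β (clock s) e → lookup (parent s) L ≡ just (just accept) →
                  confirmation β s (suc e) L ≡ just (parent s)
  confirmation⁺ {e} a acc with activeLayer? β (clock s) e ×-dec accepted? (parent s) L
  ... | yes _ = refl
  ... | no ¬c = contradiction (a , acc) ¬c

  confirmation⁻ : ∀ d {m} → confirmation β s d L ≡ just m → Matches β (clock s) d s L m
  confirmation⁻ (suc e) eq with activeLayer? β (clock s) e ×-dec accepted? (parent s) L
  confirmation⁻ (suc e) refl | yes (a , acc) = confirms refl a acc
  confirmation⁻ (suc e) ()   | no _

  nextMate⁺ : ∀ {t d m} → clock s ≡ t → mate s ≡ nothing → depth s ≡ just d → Matches β t d s L m →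
              nextMate β s L ≡ just m
  nextMate⁺ refl m≡ d≡ match with mate s | m≡ | depth s | d≡
  ... | nothing | refl | just d | refl with activeLayer? β (clock s) (suc d) | match
  ...   | yes _  | adopts _ fp          = fp
  ...   | yes a  | confirms refl a' _   = contradiction (activeLayer-injective a a') (m≢1+n+m _ ∘ sym)
  ...   | no ¬a  | adopts a _           = contradiction a ¬a
  ...   | no _   | confirms refl a' acc = confirmation⁺ a' acc

  nextMate⁻ : ∀ {t m} → clock s ≡ t → mate s ≡ nothing → nextMate β s L ≡ just m →
              ∃ λ d → depth s ≡ just d × Matches β t d s L m
  nextMate⁻ refl m≡ eq with mate s | m≡ | depth s
  nextMate⁻ refl m≡ () | nothing | refl | nothing
  ... | nothing | refl | just d with activeLayer? β (clock s) (suc d)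
  ...   | yes a = d , refl , adopts a eq
  ...   | no _  = d , refl , confirmation⁻ d eq

module Execution {n} (G : Graph n) (ID : Fin n → ℕ) (ID-injective : Injective _≡_ _≡_ ID)
                 (β : ℕ) (R : EdgeRel n) (R-edges : IsEdgeSet G R) where

  node : ℕ → Fin n → Node
  node t u = run matchingAlgorithm G ID β R t u

  signal : ℕ → Fin n → ℕ → Maybe (Msg 1 n)
  signal t w x = message β (node t w) x

  inbox : ℕ → Fin n → Inbox (n * 1)
  inbox t u = map < ID , (λ w → signal t w (ID u)) > (neighbours G u)

  incidentInputs : Fin n → List (ℕ × Bool)
  incidentInputs u = map < ID , R u > (neighbours G u)

  clock-node : ∀ t u → clock (node t u) ≡ t
  clock-node zero    u = refl
  clock-node (suc t) u = cong suc (clock-node t u)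

  inputs-node : ∀ t u → inputs (node t u) ≡ incidentInputs u
  inputs-node zero    u = refl
  inputs-node (suc t) u = inputs-node t u

  position-step : ∀ t u {d} → depth (node t u) ≡ just d →
                  depth (node (suc t) u) ≡ just d × parent (node (suc t) u) ≡ parent (node t u)
  position-step t u d≡ = cong proj₁ step≡ , cong proj₂ step≡
    where step≡ = nextPosition-persists β {L = inbox t u} d≡

  position-persists : ∀ {t t'} u {d} → t ≤ t' → depth (node t u) ≡ just d →
                      depth (node t' u) ≡ just d × parent (node t' u) ≡ parent (node t u)
  position-persists {t} u {d} t≤t' d≡ =
    persists (λ t' → depth (node t' u) ≡ just d × parent (node t' u) ≡ parent (node t u))
             (λ {t'} (d≡ , p≡) → proj₁ (position-step t' u d≡) , trans (proj₂ (position-step t' u d≡)) p≡)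
             t≤t' (d≡ , refl)

  depth-persists : ∀ {t t'} u {d} → t ≤ t' → depth (node t u) ≡ just d → depth (node t' u) ≡ just d
  depth-persists u t≤t' d≡ = proj₁ (position-persists u t≤t' d≡)

  mate-step : ∀ t u {m} → mate (node t u) ≡ just m → mate (node (suc t) u) ≡ just m
  mate-step t u = nextMate-persists β {L = inbox t u}

  mate-persists : ∀ {t t'} u {m} → t ≤ t' → mate (node t u) ≡ just m → mate (node t' u) ≡ just m
  mate-persists u {m} = persists (λ t → mate (node t u) ≡ just m) (λ {t} → mate-step t u)

  root-depth : ∀ t {u w} → R u w ≡ true → depth (node t u) ≡ just 0
  root-depth t {u} {w} uw = depth-persists {0} {t} u z≤n
    (rootDepth⁺ (incidentInputs u) (proj₂ (firstKeyWith⁺ ID (R u) id (∈-neighbours⁺ G (proj₂ R-edges u w uw)) uw)))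

  depth-onset : ∀ t u {d} → depth (node t u) ≡ just d → d ≤ t × d ≤ β × depth (node d u) ≡ just d
  depth-onset zero u d≡ with rootDepth⁻ (incidentInputs u) d≡
  ... | refl , _ = z≤n , z≤n , d≡
  depth-onset (suc t) u d≡ with maybe-case (depth (node t u))
  ... | inj₂ (d' , d'≡) with trans (sym (proj₁ (position-step t u d'≡))) d≡
  ...   | refl with depth-onset t u d'≡
  ...     | d≤t , d≤β , onset = m≤n⇒m≤1+n d≤t , d≤β , onset
  depth-onset (suc t) u d≡ | inj₁ none with nextPosition⁻ β {L = inbox t u} (clock-node t u) none d≡
  ... | t<β , refl , _ = ≤-refl , t<β , d≡

  depth-zero⇒root : ∀ t u → depth (node t u) ≡ just 0 → ∃ λ w → R u w ≡ true
  depth-zero⇒root t u d≡ with rootDepth⁻ (incidentInputs u) (proj₂ (proj₂ (depth-onset t u d≡)))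
  ... | _ , _ , fk with firstKeyWith⁻ ID (R u) id (neighbours G u) fk
  ...   | w , _ , _ , uw = w , uw

  explorer-depth : ∀ {t w x} → t < β → signal t w x ≡ just propose → depth (node t w) ≡ just t
  explorer-depth {t} {w} t<β eq with message-propose⁻ β (clock-node t w) eq
  ... | _ , d≡ , inj₁ (_ , refl)         = d≡
  ... | _ , _  , inj₂ ((β≤t , _) , _) = contradiction β≤t (<⇒≱ t<β)

  depth-parent : ∀ t u {d} → depth (node t u) ≡ just (suc d) →
                 ∃ λ p → adj G u p ≡ true × parent (node t u) ≡ ID p × depth (node t p) ≡ just d
  depth-parent zero u d≡ with rootDepth⁻ (incidentInputs u) d≡
  ... | () , _
  depth-parent (suc t) u d≡ with maybe-case (depth (node t u))
  ... | inj₂ (d' , d'≡) with trans (sym (proj₁ (position-step t u d'≡))) d≡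
  ...   | refl with depth-parent t u d'≡
  ...     | p , up , p≡ , dp =
    p , up , trans (proj₂ (position-step t u d'≡)) p≡ , proj₁ (position-step t p dp)
  depth-parent (suc t) u d≡ | inj₁ none with nextPosition⁻ β {L = inbox t u} (clock-node t u) none d≡
  ... | t<β , refl , fp with firstKeyWith⁻ ID (λ w → signal t w (ID u)) isProposal (neighbours G u) fp
  ...   | p , p∈ , p≡ , invited =
    p , ∈-neighbours⁻ G p∈ , p≡ , proj₁ (position-step t p (explorer-depth t<β (isProposal⁻ invited)))

  Reached : ℕ → Fin n → Set
  Reached t u = ∃ λ d → depth (node t u) ≡ just d

  reached-persists : ∀ {t t'} u → t ≤ t' → Reached t u → Reached t' u
  reached-persists u t≤t' (d , d≡) = d , depth-persists u t≤t' d≡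

  reached-neighbour : ∀ {t x y} → t < β → adj G y x ≡ true → Reached t x → Reached (suc t) y
  reached-neighbour {t} {x} {y} t<β yx (d , d≡) with depth-onset t x d≡
  ... | d≤t , _ , onset = reached-persists y (s≤s d≤t) joined
    where
      d<β : d < β
      d<β = ≤-<-trans d≤t t<β
      invitation : signal d x (ID y) ≡ just propose
      invitation = message-propose⁺ β (clock-node d x) onset (inj₁ (d<β , refl))
      joined : Reached (suc d) y
      joined with maybe-case (depth (node d y))
      ... | inj₂ (e , e≡) = e , proj₁ (position-step d y e≡)
      ... | inj₁ none = suc d , cong proj₁ (nextPosition⁺ β {L = inbox d y} (clock-node d y) none d<β first)
        where first = proj₂ (firstKeyWith⁺ ID (λ w → signal d w (ID y)) isProposal
                                           (∈-neighbours⁺ G yx) (cong isProposal invitation))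

  reached-within : ∀ {d u v u' v'} → Within G d (u , v) (u' , v') → adj G u v ≡ true → R u' v' ≡ true →
                   d ≤ β → Reached d u × Reached d v
  reached-within {d} {u} {v} here uv r _ =
    (0 , root-depth d r) , (0 , root-depth d (trans (proj₁ R-edges v u) r))
  reached-within {suc d} {u} {v} (step ab touch w) uv r d<β
    with reached-within w ab r (≤-trans (n≤1+n d) d<β)
  ... | ra , rb with touch
  ...   | inj₁ (inj₁ refl) = reached-persists u (n≤1+n d) ra , reached-neighbour d<β (adj-sym G uv) ra
  ...   | inj₁ (inj₂ refl) = reached-persists u (n≤1+n d) rb , reached-neighbour d<β (adj-sym G uv) rb
  ...   | inj₂ (inj₁ refl) = reached-neighbour d<β uv ra , reached-persists v (n≤1+n d) ra
  ...   | inj₂ (inj₂ refl) = reached-neighbour d<β uv rb , reached-persists v (n≤1+n d) rb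

  mate-onset : ∀ {t u m} → mate (node t u) ≡ just m →
               ∃ λ s → s < t × mate (node s u) ≡ nothing ×
                 ∃ λ d → depth (node s u) ≡ just d × Matches β s d (node s u) (inbox s u) m
  mate-onset {u = u} m≡ with just-onset (λ t → mate (node t u)) (λ {t} → mate-step t u) refl m≡
  ... | s , s<t , none , some = s , s<t , none , nextMate⁻ β {L = inbox s u} (clock-node s u) none some

  matching-proposal : ∀ {s u m} → β ≤ s → firstProposer (inbox s u) ≡ just m →
                      ∃ λ w → adj G u w ≡ true × m ≡ ID w ×
                        ∃ λ d → depth (node s w) ≡ just d × Proposes β s d (node s w) (ID u)
  matching-proposal {s} {u} β≤s fp with firstKeyWith⁻ ID (λ w → signal s w (ID u)) isProposal (neighbours G u) fp
  ... | w , w∈ , m≡ , proposal with message-propose⁻ β (clock-node s w) (isProposal⁻ proposal)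
  ...   | d , d≡ , inj₂ p            = w , ∈-neighbours⁻ G w∈ , m≡ , d , d≡ , p
  ...   | _ , _  , inj₁ (s<β , _) = contradiction β≤s (<⇒≱ s<β)

  active-stays-unmatched : ∀ {s v d} → ActiveLayer β s d → depth (node s v) ≡ just d →
                           mate (node s v) ≡ nothing → mate (node (suc s) v) ≡ nothing
  active-stays-unmatched {s} {v} active d≡ unmatched with maybe-case (mate (node (suc s) v))
  ... | inj₁ none = none
  ... | inj₂ (_ , some) with nextMate⁻ β {L = inbox s v} (clock-node s v) unmatched some
  ...   | _ , d'≡ , match with trans (sym d≡) d'≡
  ...     | refl with match
  ...       | adopts active' _      = contradiction (activeLayer-injective active active') (1+n≢n ∘ sym)
  ...       | confirms refl active' _ = contradiction (activeLayer-injective active active') 1+n≢n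

  proposal-accepted : ∀ {s u v d} → adj G v u ≡ true → depth (node s u) ≡ just d →
                      depth (node s v) ≡ just (suc d) → Proposes β s (suc d) (node s v) (ID u) →
                      mate (node (suc s) u) ≡ just (ID v) → mate (node (2 + s) v) ≡ just (ID u)
  proposal-accepted {s} {u} {v} {d} vu du dv (active , _ , unmatched , u≡parent) adopted =
    trans (nextMate⁺ β {L = inbox (suc s) v} (clock-node (suc s) v)
                     (active-stays-unmatched active dv unmatched) (proj₁ (position-step s v dv)) confirmed)
          (cong just parent≡)
    where
      parent≡ : parent (node (suc s) v) ≡ ID u
      parent≡ = trans (proj₂ (position-step s v dv)) (sym u≡parent)
      acceptance : signal (suc s) u (ID v) ≡ just accept
      acceptance = message-accept⁺ β (clock-node (suc s) u) (proj₁ (position-step s u du))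
                                   (activeLayer-suc active , adopted)
      accepted : lookup (parent (node (suc s) v)) (inbox (suc s) v) ≡ just (just accept)
      accepted = subst (λ p → lookup p (inbox (suc s) v) ≡ just (just accept)) (sym parent≡)
        (trans (lookup-∈ ID (λ w → signal (suc s) w (ID v)) ID-injective (∈-neighbours⁺ G vu))
               (cong just acceptance))
      confirmed : Matches β (suc s) (suc d) (node (suc s) v) (inbox (suc s) v) (parent (node (suc s) v))
      confirmed = confirms refl (activeLayer-suc active) accepted

  partner : ∀ {u m} → mate (node (2 * β) u) ≡ just m →
            ∃ λ v → adj G u v ≡ true × m ≡ ID v × mate (node (2 * β) v) ≡ just (ID u)
  partner {u} m≡ with mate-onset {2 * β} m≡
  ... | s , _ , unmatched , d , du , adopts active fp with matching-proposal (proj₁ active) fp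
  ...   | v , uv , refl , _ , dv , proposal@(active' , 2≤ , _) with activeLayer-injective active active'
  ...     | refl = v , uv , refl , mate-persists {2 + s} {2 * β} v (activeLayer-≤ active' 2≤)
                     (proposal-accepted (adj-sym G uv) du dv proposal
                       (nextMate⁺ β {L = inbox s u} (clock-node s u) unmatched du (adopts active fp)))
  partner {u} m≡ | s , s<2β , _ , d , du , confirms refl active acc
    with lookup⁻ ID (λ w → signal s w (ID u)) (neighbours G u) acc
  ... | v , v∈ , parent≡ , acceptance =
    v , ∈-neighbours⁻ G v∈ , parent≡ ,
    mate-persists {s} {2 * β} v (<⇒≤ s<2β) (message-accept⁻ β {s = node s v} acceptance)

  mate-symmetric : ∀ {u v} → mate (node (2 * β) u) ≡ just (ID v) → mate (node (2 * β) v) ≡ just (ID u)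
  mate-symmetric {u} m≡ with partner {u} m≡
  ... | _ , _ , v≡ , m'≡ with ID-injective v≡
  ...   | refl = m'≡

  root-unmatched : ∀ t {u w} → R u w ≡ true → mate (node t u) ≡ nothing
  root-unmatched t {u} r with maybe-case (mate (node t u))
  ... | inj₁ none = none
  ... | inj₂ (_ , some) with mate-onset {t} some
  ...   | s , _ , _ , _ , du , match with trans (sym du) (root-depth s r)
  ...     | refl with match
  ...       | confirms () _ _
  ...       | adopts active fp with matching-proposal (proj₁ active) fp
  ...         | _ , _ , _ , _ , _ , (active' , 2≤d , _) with activeLayer-injective active active'
  ...           | refl = contradiction 2≤d λ { (s≤s ()) }

  parent-matched : ∀ {x k} → depth (node β x) ≡ just (2 + k) → mate (node (2 * β) x) ≡ nothing →
                   ∃ λ p → adj G x p ≡ true × ∃ λ m → mate (node (2 * β) p) ≡ just m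
  parent-matched {x} {k} dx unmatched with depth-parent β x dx
  ... | p , xp , parent≡ , dp = p , xp , p-matched
    where
      t₀ : ℕ
      t₀ = 2 * β ∸ (2 + k)
      active : ActiveLayer β t₀ (2 + k)
      active = activeLayer-at (proj₁ (proj₂ (depth-onset β x dx)))
      t₀≤ : t₀ ≤ 2 * β
      t₀≤ = activeLayer-≤ active z≤n
      position₀ : depth (node t₀ x) ≡ just (2 + k) × parent (node t₀ x) ≡ parent (node β x)
      position₀ = position-persists x (proj₁ active) dx
      x-unmatched : mate (node t₀ x) ≡ nothing
      x-unmatched with maybe-case (mate (node t₀ x))
      ... | inj₁ none = none
      ... | inj₂ (_ , some) = contradiction (trans (sym unmatched) (mate-persists x t₀≤ some)) λ ()
      proposal : signal t₀ x (ID p) ≡ just propose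
      proposal = message-propose⁺ β (clock-node t₀ x) (proj₁ position₀)
        (inj₂ (active , s≤s (s≤s z≤n) , x-unmatched , sym (trans (proj₂ position₀) parent≡)))
      p-matched : ∃ λ m → mate (node (2 * β) p) ≡ just m
      p-matched with maybe-case (mate (node t₀ p))
      ... | inj₂ (m , some) = m , mate-persists p t₀≤ some
      ... | inj₁ none with firstKeyWith⁺ ID (λ w → signal t₀ w (ID p)) isProposal
                             (∈-neighbours⁺ G (adj-sym G xp)) (cong isProposal proposal)
      ...   | m , fp = m , mate-persists p (activeLayer-≤ active (s≤s z≤n))
                             (nextMate⁺ β {L = inbox t₀ p} (clock-node t₀ p) none
                                        (depth-persists p (proj₁ active) dp) (adopts active fp))

  Chosen : Fin n → Fin n → Set
  Chosen u v = R u v ≡ true ⊎ mate (node (2 * β) u) ≡ just (ID v)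

  chosen-sym : ∀ {u v} → Chosen u v → Chosen v u
  chosen-sym {u} {v} (inj₁ r) = inj₁ (trans (proj₁ R-edges v u) r)
  chosen-sym         (inj₂ m) = inj₂ (mate-symmetric m)

  selects⇔chosen : ∀ {u v} → adj G u v ≡ true → Selects (node (2 * β) u) (ID v) ⇔ Chosen u v
  selects⇔chosen {u} {v} uv = mk⇔ to from
    where
      input≡ : lookup (ID v) (inputs (node (2 * β) u)) ≡ just (R u v)
      input≡ = trans (cong (lookup (ID v)) (inputs-node (2 * β) u))
                     (lookup-∈ ID (R u) ID-injective (∈-neighbours⁺ G uv))
      to : Selects (node (2 * β) u) (ID v) → Chosen u v
      to (inj₁ i) = inj₁ (Maybe.just-injective (trans (sym input≡) i))
      to (inj₂ m) = inj₂ m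
      from : Chosen u v → Selects (node (2 * β) u) (ID v)
      from (inj₁ r) = inj₁ (trans input≡ (cong just r))
      from (inj₂ m) = inj₂ m

  output-symmetric : ∀ u v → adj G u v ≡ true →
    outputAt matchingAlgorithm G ID β R (2 * β) u v ≡ outputAt matchingAlgorithm G ID β R (2 * β) v u
  output-symmetric u v uv =
    does-⇔ (⇔.trans (selects⇔chosen uv)
                    (⇔.trans (mk⇔ chosen-sym chosen-sym) (⇔.sym (selects⇔chosen (adj-sym G uv)))))
           (selects? (node (2 * β) u) (ID v)) (selects? (node (2 * β) v) (ID u))

  selected : Fin n → Fin n → Bool
  selected = outputSet matchingAlgorithm G ID β R (2 * β)

  selected⁺ : ∀ {u v} → adj G u v ≡ true → Chosen u v → selected u v ≡ true
  selected⁺ {u} {v} uv c rewrite uv =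
    dec-true (selects? (node (2 * β) u) (ID v)) (Equivalence.from (selects⇔chosen uv) c)

  selected⁻ : ∀ {u v} → selected u v ≡ true → adj G u v ≡ true × Chosen u v
  selected⁻ {u} {v} eq with adj G u v in uv
  ... | true = refl , Equivalence.to (selects⇔chosen uv) (toWitness (Equivalence.from Bool.T-≡ does≡true))
    where does≡true = trans (isYes≗does (selects? (node (2 * β) u) (ID v))) eq
  selected⁻ () | false

  selected-sym : ∀ {u v} → selected u v ≡ true → selected v u ≡ true
  selected-sym s with selected⁻ s
  ... | uv , c = selected⁺ (adj-sym G uv) (chosen-sym c)

  matched⇒selects : ∀ {u m} → mate (node (2 * β) u) ≡ just m → ∃ λ w → selected u w ≡ true
  matched⇒selects {u} m≡ with partner {u} m≡
  ... | w , uw , refl , _ = w , selected⁺ uw (inj₂ m≡)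

  module _ (R-ruling : Ruling 2 β G R) where

    reached : ∀ {u v} → adj G u v ≡ true → Reached β u
    reached {u} {v} uv with proj₂ R-ruling u v uv
    ... | _ , _ , r , w = proj₁ (reached-within w uv r ≤-refl)


    selected-unique : ∀ {u v v'} → selected u v ≡ true → selected u v' ≡ true → v ≡ v'
    selected-unique {u} {v} {v'} s s' with selected⁻ s | selected⁻ s'
    ... | _ , inj₂ m | _ , inj₂ m' = ID-injective (Maybe.just-injective (trans (sym m) m'))
    ... | _ , inj₁ r | _ , inj₂ m' = contradiction (trans (sym (root-unmatched (2 * β) r)) m') λ ()
    ... | _ , inj₂ m | _ , inj₁ r' = contradiction (trans (sym (root-unmatched (2 * β) r')) m) λ ()
    ... | uv , inj₁ r | uv' , inj₁ r' with v Fin.≟ v'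
    ...   | yes v≡v' = v≡v'
    ...   | no v≢v' = contradiction (step uv' (inj₁ (inj₁ refl)) here)
                                    (proj₁ R-ruling u v u v' r r' (v≢v' ∘ sameEdge-otherEnd G uv))

    selected-independent : ∀ u v u' v' → selected u v ≡ true → selected u' v' ≡ true →
                           ¬ SameEdge (u , v) (u' , v') → ¬ Within G 1 (u , v) (u' , v')
    selected-independent u v u' v' s s' distinct here = distinct (inj₁ (refl , refl))
    selected-independent u v u' v' s s' distinct (step _ touch here) with touch
    ... | inj₁ (inj₁ refl) = distinct (inj₁ (refl , selected-unique s s'))
    ... | inj₁ (inj₂ refl) = distinct (inj₂ (refl , selected-unique s (selected-sym s')))
    ... | inj₂ (inj₁ refl) = distinct (inj₂ (selected-unique (selected-sym s) s' , refl))
    ... | inj₂ (inj₂ refl) = distinct (inj₁ (selected-unique (selected-sym s) (selected-sym s') , refl))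

    covered : ∀ {u v} → adj G u v ≡ true →
              (∃ λ w → selected u w ≡ true) ⊎
              (∃ λ y → adj G u y ≡ true × ∃ λ z → selected y z ≡ true)
    covered {u} uv with reached uv
    ... | zero , du with depth-zero⇒root β u du
    ...   | w , r = inj₁ (w , selected⁺ (proj₂ R-edges u w r) (inj₁ r))
    covered {u} uv | suc zero , du with depth-parent β u du
    ... | p , up , _ , dp with depth-zero⇒root β p dp
    ...   | z , r = inj₂ (p , up , z , selected⁺ (proj₂ R-edges p z r) (inj₁ r))
    covered {u} uv | suc (suc k) , du with maybe-case (mate (node (2 * β) u))
    ... | inj₂ (_ , m≡) = inj₁ (matched⇒selects m≡)
    ... | inj₁ none with parent-matched du none
    ...   | p , up , _ , m≡ = inj₂ (p , up , matched⇒selects m≡)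

    selected-dominating : ∀ u v → adj G u v ≡ true →
                          ∃ λ u' → ∃ λ v' → selected u' v' ≡ true × Within G 2 (u , v) (u' , v')
    selected-dominating u v uv with covered uv
    ... | inj₁ (w , s) = u , w , s , step (proj₁ (selected⁻ s)) (inj₁ (inj₁ refl)) here
    ... | inj₂ (y , uy , z , s) =
      y , z , s , step uy (inj₁ (inj₁ refl)) (step (proj₁ (selected⁻ s)) (inj₂ (inj₁ refl)) here)

theorem4 : (c : ℕ) →
    Σ ℕ λ k → Σ (Algorithm k) λ A → Σ ℕ λ C →
      (n : ℕ) (G : Graph n) (ID : Fin n → ℕ) →
      Injective _≡_ _≡_ ID → (∀ v → ID v < (2 + n) ^ c) →
      (β : ℕ) → 2 ≤ β →
      (R : EdgeRel n) → IsEdgeSet G R → Ruling 2 β G R →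
        (∀ u v → adj G u v ≡ true →
           outputAt A G ID β R (C * β) u v ≡ outputAt A G ID β R (C * β) v u)
        × Ruling 2 2 G (outputSet A G ID β R (C * β))
theorem4 c = 1 , matchingAlgorithm , 2 , λ n G ID ID-injective _ β _ R R-edges R-ruling →
  let open Execution G ID ID-injective β R R-edges in
  output-symmetric , selected-independent R-ruling , selected-dominating R-ruling
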